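{- For every finite alphabet $\Sigma$ and all positive integers $w,a$, the relation $$\mathcal{R}_{\subseteq}(\Sigma,w,a)=\{(D,D'): D\in\mathcal{B}(\Sigma,w)^{\circledast},\ D'\in\mathcal{B}(\Sigma^{\otimes a},w)^{\circledast},\ L(D')\subseteq L(D)^{\otimes a}\}$$ is regular.
   Context: Fix a padding symbol $\#$ not in any alphabet. For an alphabet $\Gamma$, $\Gamma^{\otimes a}$ is the Cartesian power $\Gamma^a$ regarded as an alphabet. For nonempty strings $u_1,\dots,u_a$, $u_1\otimes\cdots\otimes u_a$ is the string of length $\max_i|u_i|$ whose $j$-th symbol is the tuple of $j$-th symbols of the $u_i$, with $\#$ in place of missing symbols; for a language $L$, $L^{\otimes a}=\{u_1\otimes\cdots\otimes u_a:u_i\in L\}$. A relation $R$ of tuples of nonempty strings is regular if $\{u_1\otimes\cdots\otimes u_a:(u_1,\dots,u_a)\in R\}$ is accepted by a finite automaton. ODDs. For an alphabet $\Gamma$, a $(\Gamma,w)$-layer is a tuple $B=(\ell,r,T,I,F,\iota,\phi)$ with $\ell,r\subseteq\{0,\dots,w-1\}$, $T\subseteq\ell\times(\Gamma\sqcup\{\#\})\times r$, $I\subseteq\ell$, $F\subseteq r$, Booleans $\iota,\phi$, $I=\emptyset$ if $\iota$ is false and $F=\emptyset$ if $\phi$ is false; $\mathcal{B}(\Gamma,w)$ is the set of such layers, an alphabet. A $(\Gamma,w)$-ODD of length $k$ is a string $B_1\cdots B_k$ over $\mathcal{B}(\Gamma,w)$ with $\ell(B_{i+1})=r(B_i)$,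 $\iota(B_i)$ true iff $i=1$, $\phi(B_i)$ true iff $i=k$; $\mathcal{B}(\Gamma,w)^{\circledast}$ is the set of all such ODDs of all lengths. A nonempty string $\sigma_1\cdots\sigma_{k'}$ over $\Gamma$ with $k'\le k$ is accepted by $D$ if, setting $\hat\sigma_i=\sigma_i$ for $i\le k'$ and $\hat\sigma_i=\#$ otherwise, there are transitions $(p_i,\hat\sigma_i,q_i)\in T(B_i)$ with $p_{i+1}=q_i$, $p_1\in I(B_1)$, $q_k\in F(B_k)$; $L(D)$ is the set of accepted strings. -}

module Defs where

open import Data.Nat using (ℕ; zero; suc; _≤_; _<_; _⊔_)
open import Data.Fin using (Fin; toℕ; inject₁) renaming (zero to fzero; suc to fsuc)
open import Data.Fin.Subset using (Subset; _∈_)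
open import Data.Bool using (Bool; true; false)
open import Data.Maybe using (Maybe; just; nothing)
open import Data.List using (List; []; _∷_; length; map; upTo; lookup)
open import Data.Vec as Vec using (Vec)
open import Data.Product using (Σ; ∃; ∃-syntax; _×_; _,_)
open import Relation.Binary.PropositionalEquality using (_≡_)
open import Function.Bundles using (_⇔_)

NonEmpty : {A : Set} → List A → Set
NonEmpty xs = 0 < length xs

-- j-th symbol of u, or # (= nothing) if u is too short
pad : {A : Set} → List A → ℕ → Maybe A
pad []       _       = nothing
pad (x ∷ xs) zero    = just x
pad (x ∷ xs) (suc n) = pad xs n

maxLen : {A : Set} {a : ℕ} → Vec (List A) a → ℕ
maxLen Vec.[]       = 0
maxLen (u Vec.∷ us) = length u ⊔ maxLen us

conv : {A : Set} {a : ℕ} → Vec (List A) a → List (Vec (Maybe A) a)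
conv us = map (λ j → Vec.map (λ u → pad u j) us) (upTo (maxLen us))

conv₂ : {A B : Set} → List A → List B → List (Maybe A × Maybe B)
conv₂ u v = map (λ j → (pad u j , pad v j)) (upTo (length u ⊔ length v))

Pow : {A : Set} (a : ℕ) → (List A → Set) → List (Vec (Maybe A) a) → Set
Pow a L x = Σ (Vec (List _) a) λ us → ((i : Fin a) → L (Vec.lookup us i)) × conv us ≡ x

record DFA (A : Set) : Set where
  field
    states : ℕ
    start  : Fin states
    δ      : Fin states → A → Fin states
    final  : Fin states → Bool

run : {A : Set} (M : DFA A) → Fin (DFA.states M) → List A → Fin (DFA.states M)
run M q []       = q
run M q (x ∷ xs) = run M (DFA.δ M q x) xs

AcceptsDFA : {A : Set} → DFA A → List A → Set
AcceptsDFA M x = DFA.final M (run M (DFA.start M) x) ≡ true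

Regular₂ : {A B : Set} → (List A → List B → Set) → Set
Regular₂ {A} {B} R =
  Σ (DFA (Maybe A × Maybe B)) λ M →
    (x : List (Maybe A × Maybe B)) →
      AcceptsDFA M x ⇔
      (∃[ u ] ∃[ v ] (NonEmpty u × NonEmpty v × R u v × conv₂ u v ≡ x))

-- (Γ,w)-layer.  T is a Boolean-valued relation on
-- Fin w × (Γ ⊔ {#}) × Fin w, where # is `nothing`.
record Layer (Γ : Set) (w : ℕ) : Set where
  field
    ℓ r  : Subset w
    T    : Fin w → Maybe Γ → Fin w → Bool
    I F  : Subset w
    ι φ  : Bool
    T⊆   : ∀ p σ q → T p σ q ≡ true → (p ∈ ℓ) × (q ∈ r)
    I⊆   : ∀ p → p ∈ I → p ∈ ℓ
    F⊆   : ∀ q → q ∈ F → q ∈ r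
    I-ι  : ι ≡ false → ∀ p → Vec.lookup I p ≡ false
    F-φ  : φ ≡ false → ∀ q → Vec.lookup F q ≡ false
open Layer public

-- D = B₁⋯B_k is a (Γ,w)-ODD (of length k ≥ 1), indices 0-based.
IsODD : {Γ : Set} {w : ℕ} → List (Layer Γ w) → Set
IsODD D =
  NonEmpty D ×
  ((i j : Fin (length D)) → suc (toℕ i) ≡ toℕ j → ℓ (lookup D j) ≡ r (lookup D i)) ×
  ((i : Fin (length D)) → (ι (lookup D i) ≡ true) ⇔ (toℕ i ≡ 0)) ×
  ((i : Fin (length D)) → (φ (lookup D i) ≡ true) ⇔ (suc (toℕ i) ≡ length D))

InL : {Γ : Set} {w : ℕ} → List (Layer Γ w) → List Γ → Set
InL {w = w} D s =
  NonEmpty s × length s ≤ length D ×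
  Σ (Fin (suc (length D)) → Fin w) λ st →
    ((i : Fin (length D)) → T (lookup D i) (st (inject₁ i)) (pad s (toℕ i)) (st (fsuc i)) ≡ true) ×
    ((i : Fin (length D)) → toℕ i ≡ 0 → st (inject₁ i) ∈ I (lookup D i)) ×
    ((i : Fin (length D)) → suc (toℕ i) ≡ length D → st (fsuc i) ∈ F (lookup D i))

Tensor : Set → ℕ → Set
Tensor Γ a = Vec Γ a

Rsub : (Σ' : Set) (w a : ℕ) → List (Layer Σ' w) → List (Layer (Tensor Σ' a) w) → Set
Rsub Σ' w a D D' =
  IsODD D × IsODD D' ×
  ((x : List (Tensor Σ' a)) → InL D' x → Pow a (InL D) (map (Vec.map just) x))

-- Read a pair (D, D′) letter by letter as the convolution D ⊗ D′. Being an ODD is a condition on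
-- consecutive layers, so a finite automaton checks it. A string over Σ^a lies in L(D)^{⊗a} iff each of
-- its a columns lies in L(D); hence L(D′) ⊆ L(D)^{⊗a} fails iff for some column i some y ∈ L(D′) has
-- its i-th column outside L(D). Whether a string read alongside the layers of an ODD is accepted can be
-- decided by tracking the set of reachable states, a subset of the w states of a layer. So for each i
-- the strings D ⊗ D′ ⊗ y witnessing a failure form a regular language; projecting away y (guess it
-- letter by letter, then determinise) and complementing gives one automaton per column, and the
-- intersection of these with the ODD checks recognises R_⊆.

module Submission where

open import Defs hiding (run)
open import Data.Bool using (Bool; true; false; _∧_; not)
open import Data.Bool.Properties using (¬-not; not-¬) renaming (_≟_ to _≟ᵇ_)
open import Data.Empty using (⊥-elim)
open import Data.Fin using (Fin; toℕ; fromℕ<; inject₁) renaming (zero to fzero; suc to fsuc)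
open import Data.Fin.Subset using (Subset; _∈_)
open import Data.Fin.Properties using (1↔⊤; 2↔Bool; +↔⊎; *↔×; any?; toℕ-injective; toℕ-fromℕ<; toℕ<n; toℕ-inject₁) renaming (_≟_ to _≟ᶠ_)
open import Data.List using (List; []; _∷_; length; map; foldl; _++_; replicate; zip; applyUpTo; upTo; lookup; _∷ʳ_)
open import Data.List.Properties using (length-++; length-map; length-replicate; map-upTo; map-applyUpTo; applyUpTo-∷ʳ; foldl-∷ʳ; length-upTo; map-cong; length-applyUpTo)
open import Data.List.Relation.Unary.All using (All; []; _∷_)
open import Data.List.Relation.Unary.All.Properties using (applyUpTo⁺₁; applyUpTo⁻)
open import Data.Maybe as Maybe using (Maybe; just; nothing)
open import Data.Maybe.Properties using (just-injective)
open import Data.Nat using (ℕ; zero; suc; _+_; _*_; _∸_; _⊔_; _≤_; _<_; z≤n; s≤s; _<?_; _≤?_)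
open import Data.Nat.Properties using (m≤m+n; m+[n∸m]≡n; m≤m⊔n; m≤n⊔m; ⊔-lub; ≮⇒≥; <⇒≱; ≤-antisym; suc-injective; 0≢1+n; ≤-pred; ≤-trans; ≤-reflexive; n≤1+n; n<1+n; m<n⇒m<1+n; m≤n⇒m<n∨m≡n; <⇒≢; m≤n+m; ≰⇒>; ≤-refl; <-≤-trans; m∸n+n≡m; ⊔-identityʳ; ⊔-idem) renaming (_≟_ to _≟ℕ_)
open import Data.Product using (∃; ∃-syntax; _×_; _,_; proj₁; proj₂)
open import Data.Product.Function.NonDependent.Propositional using (_×-↔_; _×-⇔_)
open import Data.Sum using (_⊎_; inj₁; inj₂)
open import Data.Sum.Function.Propositional using (_⊎-↔_)
open import Data.Unit using (⊤; tt)
open import Data.Vec as Vec using (Vec)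
open import Data.Vec.Properties using (lookup∘tabulate; ≡-dec; []=⇒lookup; lookup⇒[]=; lookup-map; tabulate∘lookup; tabulate-cong; tabulate-∘)
open import Function using (_∘_; id)
open import Function.Bundles using (_⇔_; mk⇔; Equivalence; _↔_; mk↔ₛ′; Inverse)
open import Function.Properties.Equivalence using () renaming (refl to ⇔-refl; trans to ⇔-trans; sym to ⇔-sym)
open import Function.Properties.Inverse using (↔-refl; ↔-sym; ↔-trans)
open import Relation.Binary.Definitions using (DecidableEquality)
open import Relation.Binary.PropositionalEquality
open import Relation.Nullary using (Dec; yes; no; ¬_; map′; _×-dec_)
open import Relation.Nullary.Decidable using (isYes; decidable-stable)
open import Relation.Unary using (Decidable)

private
  variable
    A B X Y : Set

open Equivalence using (to; from)

-- Finite types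

record Finite (A : Set) : Set where
  field
    size  : ℕ
    index : A ↔ Fin size

  encode : A → Fin size
  encode = Inverse.to index

  decode : Fin size → A
  decode = Inverse.from index

  decode-encode : ∀ a → decode (encode a) ≡ a
  decode-encode = Inverse.strictlyInverseʳ index

  _≟_ : DecidableEquality A
  a ≟ b = map′ (λ e → trans (sym (decode-encode a)) (trans (cong decode e) (decode-encode b)))
               (cong encode) (encode a ≟ᶠ encode b)

  any?ᶠ : {P : A → Set} → Decidable P → Dec (∃ P)
  any?ᶠ {P} P? = map′ (λ { (k , p) → decode k , p }) (λ { (a , p) → encode a , subst P (sym (decode-encode a)) p })
                      (any? (P? ∘ decode))

open Finite using (size; index)

finite-↔ : A ↔ B → Finite A → Finite B
finite-↔ A↔B FA = record { size = size FA ; index = ↔-trans (↔-sym A↔B) (index FA) }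

finite-Fin : (n : ℕ) → Finite (Fin n)
finite-Fin n = record { size = n ; index = ↔-refl }

finite-⊤ : Finite ⊤
finite-⊤ = finite-↔ 1↔⊤ (finite-Fin 1)

finite-Bool : Finite Bool
finite-Bool = finite-↔ 2↔Bool (finite-Fin 2)

finite-× : Finite A → Finite B → Finite (A × B)
finite-× FA FB = record { size = size FA * size FB ; index = ↔-trans (index FA ×-↔ index FB) (↔-sym *↔×) }

finite-⊎ : Finite A → Finite B → Finite (A ⊎ B)
finite-⊎ FA FB = record { size = size FA + size FB ; index = ↔-trans (index FA ⊎-↔ index FB) (↔-sym +↔⊎) }

finite-Maybe : Finite A → Finite (Maybe A)
finite-Maybe FA = finite-↔ ⊤⊎A↔Maybe (finite-⊎ finite-⊤ FA)
  where
  ⊤⊎A↔Maybe : (⊤ ⊎ _) ↔ Maybe _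
  ⊤⊎A↔Maybe = mk↔ₛ′ (λ { (inj₁ _) → nothing ; (inj₂ a) → just a }) (λ { nothing → inj₁ tt ; (just a) → inj₂ a })
                    (λ { nothing → refl ; (just a) → refl }) (λ { (inj₁ _) → refl ; (inj₂ a) → refl })

finite-Vec : Finite A → (n : ℕ) → Finite (Vec A n)
finite-Vec FA zero    = finite-↔ (mk↔ₛ′ (λ _ → Vec.[]) (λ _ → tt) (λ { Vec.[] → refl }) (λ _ → refl)) finite-⊤
finite-Vec FA (suc n) = finite-↔ (mk↔ₛ′ (λ (a , v) → a Vec.∷ v) (λ { (a Vec.∷ v) → a , v })
                                         (λ { (a Vec.∷ v) → refl }) (λ { (a , v) → refl }))
                                 (finite-× FA (finite-Vec FA n))

-- Automata

∧-true : {a b : Bool} → (a ∧ b ≡ true) ⇔ (a ≡ true × b ≡ true)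
∧-true {true}  = mk⇔ (refl ,_) proj₂
∧-true {false} = mk⇔ (λ ()) (λ ())

not-true : {b : Bool} → (not b ≡ true) ⇔ (¬ (b ≡ true))
not-true {true}  = mk⇔ (λ ()) (λ ¬b → ⊥-elim (¬b refl))
not-true {false} = mk⇔ (λ _ ()) (λ _ → refl)

isYes-true : {P : Set} (P? : Dec P) → (isYes P? ≡ true) ⇔ P
isYes-true (yes p) = mk⇔ (λ _ → p) (λ _ → refl)
isYes-true (no ¬p) = mk⇔ (λ ()) (λ p → ⊥-elim (¬p p))

record Automaton (X : Set) : Set₁ where
  field
    State  : Set
    finite : Finite State
    start  : State
    step   : State → X → State
    accept : State → Bool

  run : State → List X → State
  run = foldl step

  Accepts : List X → Set
  Accepts xs = accept (run start xs) ≡ true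

open Automaton

accepts-resp : (M : Automaton X) {xs ys : List X} → xs ≡ ys → Accepts M xs ⇔ Accepts M ys
accepts-resp M refl = mk⇔ id id

accepts? : (M : Automaton X) → Decidable (Accepts M)
accepts? M xs = accept M (run M (start M) xs) ≟ᵇ true

toDFA : Automaton X → DFA X
toDFA M = record
  { states = size (finite M)
  ; start  = encode (start M)
  ; δ      = λ q x → encode (step M (decode q) x)
  ; final  = accept M ∘ decode
  }
  where open Finite (finite M)

run-toDFA : (M : Automaton X) (s : State M) (xs : List X) →
  Defs.run (toDFA M) (Finite.encode (finite M) s) xs ≡ Finite.encode (finite M) (run M s xs)
run-toDFA M s []       = refl
run-toDFA M s (x ∷ xs) rewrite Finite.decode-encode (finite M) s = run-toDFA M (step M s x) xs

accepts-toDFA : (M : Automaton X) (xs : List X) → AcceptsDFA (toDFA M) xs ⇔ Accepts M xs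
accepts-toDFA M xs
  rewrite run-toDFA M (start M) xs | Finite.decode-encode (finite M) (run M (start M) xs) = mk⇔ id id

_∩ᴬ_ : Automaton X → Automaton X → Automaton X
M ∩ᴬ N = record
  { State  = State M × State N
  ; finite = finite-× (finite M) (finite N)
  ; start  = start M , start N
  ; step   = λ (s , t) x → step M s x , step N t x
  ; accept = λ (s , t) → accept M s ∧ accept N t
  }

run-∩ : (M N : Automaton X) (s : State M) (t : State N) (xs : List X) →
  run (M ∩ᴬ N) (s , t) xs ≡ (run M s xs , run N t xs)
run-∩ M N s t []       = refl
run-∩ M N s t (x ∷ xs) = run-∩ M N (step M s x) (step N t x) xs

accepts-∩ : (M N : Automaton X) (xs : List X) → Accepts (M ∩ᴬ N) xs ⇔ (Accepts M xs × Accepts N xs)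
accepts-∩ M N xs rewrite run-∩ M N (start M) (start N) xs = ∧-true

∁ᴬ : Automaton X → Automaton X
∁ᴬ M = record M { accept = not ∘ accept M }

accepts-∁ : (M : Automaton X) (xs : List X) → Accepts (∁ᴬ M) xs ⇔ (¬ Accepts M xs)
accepts-∁ M xs = not-true

comapᴬ : (Y → X) → Automaton X → Automaton Y
comapᴬ f M = record
  { State = State M ; finite = finite M ; start = start M ; step = λ s y → step M s (f y) ; accept = accept M }

run-comap : (f : Y → X) (M : Automaton X) (s : State M) (ys : List Y) →
  run (comapᴬ f M) s ys ≡ run M s (map f ys)
run-comap f M s []       = refl
run-comap f M s (y ∷ ys) = run-comap f M (step M s (f y)) ys

accepts-comap : (f : Y → X) (M : Automaton X) (ys : List Y) → Accepts (comapᴬ f M) ys ⇔ Accepts M (map f ys)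
accepts-comap f M ys rewrite run-comap f M (start M) ys = mk⇔ id id

universalᴬ : Automaton X
universalᴬ = record { State = ⊤ ; finite = finite-⊤ ; start = tt ; step = λ _ _ → tt ; accept = λ _ → true }

⋂ᴬ : {n : ℕ} → (Fin n → Automaton X) → Automaton X
⋂ᴬ {n = zero}  M = universalᴬ
⋂ᴬ {n = suc n} M = M fzero ∩ᴬ ⋂ᴬ (M ∘ fsuc)

accepts-⋂ : {n : ℕ} (M : Fin n → Automaton X) (xs : List X) → Accepts (⋂ᴬ M) xs ⇔ (∀ i → Accepts (M i) xs)
accepts-⋂ {n = zero}  M xs = mk⇔ (λ _ ()) (λ _ → refl)
accepts-⋂ {n = suc n} M xs = mk⇔
  (λ acc → let (acc₀ , accₛ) = accepts-∩ (M fzero) (⋂ᴬ (M ∘ fsuc)) xs .to acc in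
           λ { fzero → acc₀ ; (fsuc i) → accepts-⋂ (M ∘ fsuc) xs .to accₛ i })
  (λ acc → accepts-∩ (M fzero) (⋂ᴬ (M ∘ fsuc)) xs .from
             (acc fzero , accepts-⋂ (M ∘ fsuc) xs .from (acc ∘ fsuc)))

allᴬ : {P : X → Set} → Decidable P → Automaton X
allᴬ P? = record { State = Bool ; finite = finite-Bool ; start = true ; step = λ b x → b ∧ isYes (P? x) ; accept = id }

accepts-all : {P : X → Set} (P? : Decidable P) (xs : List X) → Accepts (allᴬ P?) xs ⇔ All P xs
accepts-all {P = P} P? xs = mk⇔ (proj₂ ∘ run-all true xs .to) (λ all → run-all true xs .from (refl , all))
  where
  run-all : ∀ b xs → (run (allᴬ P?) b xs ≡ true) ⇔ (b ≡ true × All P xs)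
  run-all b []       = mk⇔ (_, []) proj₁
  run-all b (x ∷ xs) = mk⇔
    (λ acc → let (b∧Px , all) = run-all (b ∧ isYes (P? x)) xs .to acc
                 (b-true , Px) = ∧-true .to b∧Px
             in b-true , isYes-true (P? x) .to Px ∷ all)
    (λ { (b-true , Px ∷ all) → run-all (b ∧ isYes (P? x)) xs .from
                                   (∧-true .from (b-true , isYes-true (P? x) .from Px) , all) })

skipᴬ : Automaton X → Automaton (Maybe X)
skipᴬ M = record
  { State = State M ; finite = finite M ; start = start M ; accept = accept M
  ; step  = λ { s nothing → s ; s (just x) → step M s x }
  }

run-skip : (M : Automaton X) (s : State M) (xs : List X) (r : ℕ) →
  run (skipᴬ M) s (map just xs ++ replicate r nothing) ≡ run M s xs
run-skip M s (x ∷ xs) r       = run-skip M (step M s x) xs r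
run-skip M s []       zero    = refl
run-skip M s []       (suc r) = run-skip M s [] r

accepts-skip : (M : Automaton X) (xs : List X) (r : ℕ) →
  Accepts (skipᴬ M) (map just xs ++ replicate r nothing) ⇔ Accepts M xs
accepts-skip M xs r rewrite run-skip M (start M) xs r = mk⇔ id id

module _ (FY : Finite Y) (M : Automaton (X × Y)) where
  open Finite (finite M) using (encode; decode; decode-encode; _≟_; any?ᶠ)

  Subsetᴬ : Set
  Subsetᴬ = Vec Bool (size (finite M))

  _∈ᴬ_ : State M → Subsetᴬ → Set
  s ∈ᴬ P = Vec.lookup P (encode s) ≡ true

  subsetOf : (State M → Bool) → Subsetᴬ
  subsetOf f = Vec.tabulate (f ∘ decode)

  ∈-subsetOf : ∀ f s → s ∈ᴬ subsetOf f ⇔ (f s ≡ true)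
  ∈-subsetOf f s = mk⇔ (trans (sym lookup≡)) (trans lookup≡)
    where
    lookup≡ : Vec.lookup (subsetOf f) (encode s) ≡ f s
    lookup≡ = trans (lookup∘tabulate (f ∘ decode) (encode s)) (cong f (decode-encode s))

  reachable? : (P : Subsetᴬ) (x : X) (t : State M) → Dec (∃[ s ] s ∈ᴬ P × ∃[ y ] step M s (x , y) ≡ t)
  reachable? P x t = any?ᶠ λ s → (Vec.lookup P (encode s) ≟ᵇ true) ×-dec Finite.any?ᶠ FY (λ y → step M s (x , y) ≟ t)

  accepting? : (P : Subsetᴬ) → Dec (∃[ s ] s ∈ᴬ P × accept M s ≡ true)
  accepting? P = any?ᶠ λ s → (Vec.lookup P (encode s) ≟ᵇ true) ×-dec (accept M s ≟ᵇ true)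

  -- the subset construction applied to the automaton that guesses the Y-component of each letter
  ∃ᴬ : Automaton X
  ∃ᴬ = record
    { State  = Subsetᴬ
    ; finite = finite-Vec finite-Bool _
    ; start  = subsetOf λ t → isYes (start M ≟ t)
    ; step   = λ P x → subsetOf (isYes ∘ reachable? P x)
    ; accept = isYes ∘ accepting?
    }

  ∈-start : ∀ s → s ∈ᴬ Automaton.start ∃ᴬ ⇔ start M ≡ s
  ∈-start s = ⇔-trans (∈-subsetOf _ s) (isYes-true (start M ≟ s))

  ∈-step : ∀ P x s → s ∈ᴬ step ∃ᴬ P x ⇔ (∃[ s₀ ] s₀ ∈ᴬ P × ∃[ y ] step M s₀ (x , y) ≡ s)
  ∈-step P x s = ⇔-trans (∈-subsetOf _ s) (isYes-true (reachable? P x s))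
  ∈-run : ∀ P xs s → s ∈ᴬ run ∃ᴬ P xs ⇔
    (∃[ s₀ ] s₀ ∈ᴬ P × ∃[ ys ] length ys ≡ length xs × run M s₀ (zip xs ys) ≡ s)
  ∈-run P []       s = mk⇔ (λ s∈P → s , s∈P , [] , refl , refl) λ { (s₀ , s₀∈P , _ , _ , refl) → s₀∈P }
  ∈-run P (x ∷ xs) s = mk⇔
    (λ s∈ → let (s₁ , s₁∈ , ys , |ys| , run≡) = ∈-run (step ∃ᴬ P x) xs s .to s∈
                (s₀ , s₀∈P , y , step≡) = ∈-step P x s₁ .to s₁∈
            in s₀ , s₀∈P , y ∷ ys , cong suc |ys| , trans (cong (λ t → run M t (zip xs ys)) step≡) run≡)
    λ { (s₀ , s₀∈P , y ∷ ys , |ys| , run≡) →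
          ∈-run (step ∃ᴬ P x) xs s .from
            (step M s₀ (x , y) , ∈-step P x _ .from (s₀ , s₀∈P , y , refl) , ys , suc-injective |ys| , run≡) }

  accepts-∃ : ∀ xs → Accepts ∃ᴬ xs ⇔ (∃[ ys ] length ys ≡ length xs × Accepts M (zip xs ys))
  accepts-∃ xs = mk⇔
    (λ acc → let (s , s∈ , acc-s) = isYes-true (accepting? (run ∃ᴬ (start ∃ᴬ) xs)) .to acc
                 (s₀ , s₀∈ , ys , |ys| , run≡) = ∈-run (start ∃ᴬ) xs s .to s∈
             in ys , |ys| , subst (λ t → accept M (run M t (zip xs ys)) ≡ true)
                                  (sym (∈-start s₀ .to s₀∈)) (subst (λ t → accept M t ≡ true) (sym run≡) acc-s))
    (λ (ys , |ys| , acc) → isYes-true (accepting? (run ∃ᴬ (start ∃ᴬ) xs)) .from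
        ( run M (start M) (zip xs ys)
        , ∈-run (start ∃ᴬ) xs _ .from (start M , ∈-start (start M) .from refl , ys , |ys| , refl)
        , acc ))

-- Padded strings

pad-just : (u : List A) (j : ℕ) → j < length u → ∃[ a ] pad u j ≡ just a
pad-just (a ∷ u) zero    _         = a , refl
pad-just (a ∷ u) (suc j) (s≤s j<u) = pad-just u j j<u

pad-nothing : (u : List A) (j : ℕ) → length u ≤ j → pad u j ≡ nothing
pad-nothing []      j       _         = refl
pad-nothing (a ∷ u) (suc j) (s≤s u≤j) = pad-nothing u j u≤j

just≢nothing : {a : A} → just a ≢ nothing
just≢nothing ()

pad-map : (f : A → B) (u : List A) (j : ℕ) → pad (map f u) j ≡ Maybe.map f (pad u j)
pad-map f []      j       = refl
pad-map f (a ∷ u) zero    = refl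
pad-map f (a ∷ u) (suc j) = pad-map f u j

pad-lookup : (u : List A) (i : Fin (length u)) → pad u (toℕ i) ≡ just (lookup u i)
pad-lookup (a ∷ u) fzero    = refl
pad-lookup (a ∷ u) (fsuc i) = pad-lookup u i

pad-applyUpTo : (f : ℕ → A) {n j : ℕ} → j < n → pad (applyUpTo f n) j ≡ just (f j)
pad-applyUpTo f {suc n} {zero}  _         = refl
pad-applyUpTo f {suc n} {suc j} (s≤s j<n) = pad-applyUpTo (f ∘ suc) j<n

pad-injective : {u v : List A} → (∀ j → pad u j ≡ pad v j) → u ≡ v
pad-injective {u = []}    {[]}    _   = refl
pad-injective {u = []}    {_ ∷ _} pad≗ with () ← pad≗ 0
pad-injective {u = _ ∷ _} {[]}    pad≗ with () ← pad≗ 0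
pad-injective {u = a ∷ u} {b ∷ v} pad≗ = cong₂ _∷_ (just-injective (pad≗ 0)) (pad-injective (pad≗ ∘ suc))

length≤⇔padding : (u : List A) (k n : ℕ) → length u ≤ n → (length u ≤ k) ⇔ (∀ j → k ≤ j → j < n → pad u j ≡ nothing)
length≤⇔padding u k n u≤n = mk⇔ (λ u≤k j k≤j _ → pad-nothing u j (≤-trans u≤k k≤j)) from′
  where
  from′ : (∀ j → k ≤ j → j < n → pad u j ≡ nothing) → length u ≤ k
  from′ only# with length u ≤? k
  ... | yes u≤k = u≤k
  ... | no  u≰k with pad-just u k (≰⇒> u≰k)
  ... | a , padu≡a = ⊥-elim (just≢nothing (trans (sym padu≡a) (only# k ≤-refl (<-≤-trans (≰⇒> u≰k) u≤n))))

applyUpTo-cong : {f g : ℕ → A} → (∀ j → f j ≡ g j) → ∀ n → applyUpTo f n ≡ applyUpTo g n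
applyUpTo-cong f≗g zero    = refl
applyUpTo-cong f≗g (suc n) = cong₂ _∷_ (f≗g 0) (applyUpTo-cong (f≗g ∘ suc) n)

applyUpTo-pad : (f : Maybe A → B) (x : List A) → applyUpTo (f ∘ pad x) (length x) ≡ map (f ∘ just) x
applyUpTo-pad f []      = refl
applyUpTo-pad f (a ∷ x) = cong (f (just a) ∷_) (applyUpTo-pad f x)

zip-applyUpTo : (f : ℕ → A) (g : ℕ → B) (n : ℕ) → zip (applyUpTo f n) (applyUpTo g n) ≡ applyUpTo (λ j → f j , g j) n
zip-applyUpTo f g zero    = refl
zip-applyUpTo f g (suc n) = cong ((f 0 , g 0) ∷_) (zip-applyUpTo (f ∘ suc) (g ∘ suc) n)

zip-map-proj : (x : List (A × B)) → zip (map proj₁ x) (map proj₂ x) ≡ x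
zip-map-proj []      = refl
zip-map-proj (c ∷ x) = cong (c ∷_) (zip-map-proj x)

map-proj₂-zip : (xs : List A) (ys : List B) → length ys ≡ length xs → map proj₂ (zip xs ys) ≡ ys
map-proj₂-zip []       []       _     = refl
map-proj₂-zip (x ∷ xs) (y ∷ ys) |ys|≡ = cong (y ∷_) (map-proj₂-zip xs ys (suc-injective |ys|≡))

padTo : ℕ → List A → List (Maybe A)
padTo n u = applyUpTo (pad u) n

padTo-++ : (u : List A) (r : ℕ) → padTo (length u + r) u ≡ map just u ++ replicate r nothing
padTo-++ (a ∷ u) r       = cong (just a ∷_) (padTo-++ u r)
padTo-++ []      zero    = refl
padTo-++ []      (suc r) = cong (nothing ∷_) (padTo-++ [] r)

length-padded : (u : List A) (r : ℕ) → length (map just u ++ replicate r nothing) ≡ length u + r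
length-padded u r = trans (length-++ (map just u)) (cong₂ _+_ (length-map just u) (length-replicate r))

padded-padTo : {u : List A} {r : ℕ} (zs : List (Maybe A)) → zs ≡ map just u ++ replicate r nothing →
  length u ≤ length zs × zs ≡ padTo (length zs) u
padded-padTo {u = u} {r} zs refl rewrite length-padded u r = m≤m+n (length u) r , sym (padTo-++ u r)

padTo-padded : (u : List A) (n : ℕ) → length u ≤ n → padTo n u ≡ map just u ++ replicate (n ∸ length u) nothing
padTo-padded u n u≤n = trans (cong (λ m → padTo m u) (sym (m+[n∸m]≡n u≤n))) (padTo-++ u (n ∸ length u))

Padded : List (Maybe A) → Set
Padded {A} zs = ∃[ u ] ∃[ r ] NonEmpty u × zs ≡ map just u ++ replicate r nothing

data PadPhase : Set where
  before-word in-word in-padding rejected : PadPhase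

finite-PadPhase : Finite PadPhase
finite-PadPhase = finite-↔ Fin4↔PadPhase (finite-Fin 4)
  where
  Fin4↔PadPhase : Fin 4 ↔ PadPhase
  Fin4↔PadPhase = mk↔ₛ′
    (λ { fzero → before-word ; (fsuc fzero) → in-word ; (fsuc (fsuc fzero)) → in-padding ; (fsuc (fsuc (fsuc fzero))) → rejected })
    (λ { before-word → fzero ; in-word → fsuc fzero ; in-padding → fsuc (fsuc fzero) ; rejected → fsuc (fsuc (fsuc fzero)) })
    (λ { before-word → refl ; in-word → refl ; in-padding → refl ; rejected → refl })
    (λ { fzero → refl ; (fsuc fzero) → refl ; (fsuc (fsuc fzero)) → refl ; (fsuc (fsuc (fsuc fzero))) → refl })

paddedᴬ : Automaton (Maybe A)
paddedᴬ = record { State = PadPhase ; finite = finite-PadPhase ; start = before-word ; step = step′ ; accept = accept′ }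
  where
  step′ : PadPhase → Maybe _ → PadPhase
  step′ before-word (just _) = in-word
  step′ in-word     (just _) = in-word
  step′ in-word     nothing  = in-padding
  step′ in-padding  nothing  = in-padding
  step′ _           _        = rejected
  accept′ : PadPhase → Bool
  accept′ in-word    = true
  accept′ in-padding = true
  accept′ _          = false

module _ {A : Set} where
  private
    M = paddedᴬ {A}

  rejects : ∀ zs → ¬ (accept M (run M rejected zs) ≡ true)
  rejects []       ()
  rejects (_ ∷ zs) = rejects zs

  from-padding : ∀ zs → accept M (run M in-padding zs) ≡ true → ∃[ r ] zs ≡ replicate r nothing
  from-padding []             _   = 0 , refl
  from-padding (nothing ∷ zs) acc = let (r , eq) = from-padding zs acc in suc r , cong (nothing ∷_) eq
  from-padding (just _ ∷ zs)  acc = ⊥-elim (rejects zs acc)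

  from-word : ∀ zs → accept M (run M in-word zs) ≡ true → ∃[ u ] ∃[ r ] zs ≡ map just u ++ replicate r nothing
  from-word []             _   = [] , 0 , refl
  from-word (just a ∷ zs)  acc = let (u , r , eq) = from-word zs acc in a ∷ u , r , cong (just a ∷_) eq
  from-word (nothing ∷ zs) acc = let (r , eq) = from-padding zs acc in [] , suc r , cong (nothing ∷_) eq

  to-word : ∀ u r → accept M (run M in-word (map just u ++ replicate r nothing)) ≡ true
  to-word (_ ∷ u) r       = to-word u r
  to-word []      zero    = refl
  to-word []      (suc r) = to-padding r
    where
    to-padding : ∀ r → accept M (run M in-padding (replicate r nothing)) ≡ true
    to-padding zero    = refl
    to-padding (suc r) = to-padding r

  accepts-padded : ∀ zs → Accepts M zs ⇔ Padded zs
  accepts-padded []             = mk⇔ (λ ()) λ { ([] , _ , () , _) ; (_ ∷ _ , _ , _ , ()) }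
  accepts-padded (nothing ∷ zs) = mk⇔ (⊥-elim ∘ rejects zs) λ { ([] , _ , () , _) ; (_ ∷ _ , _ , _ , ()) }
  accepts-padded (just a ∷ zs)  = mk⇔
    (λ acc → let (u , r , eq) = from-word zs acc in a ∷ u , r , s≤s z≤n , cong (just a ∷_) eq)
    λ { (_ ∷ u , r , _ , refl) → to-word u r }

-- (#, #) is the one letter that never occurs in a convolution
data NonBlank {A B : Set} : Maybe A × Maybe B → Set where
  left  : ∀ {a y} → NonBlank (just a , y)
  right : ∀ {x b} → NonBlank (x , just b)

nonBlank? : Decidable (NonBlank {A} {B})
nonBlank? (just a  , y)      = yes left
nonBlank? (nothing , just b) = yes right
nonBlank? (nothing , nothing) = no λ ()

conv₂-proj₁ : (u : List A) (v : List B) →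
  map proj₁ (conv₂ u v) ≡ map just u ++ replicate (length u ⊔ length v ∸ length u) nothing
conv₂-proj₁ u v = begin
  map proj₁ (conv₂ u v)                          ≡⟨ cong (map proj₁) (map-upTo _ _) ⟩
  map proj₁ (applyUpTo (λ j → pad u j , pad v j) _) ≡⟨ map-applyUpTo _ proj₁ _ ⟩
  padTo (length u ⊔ length v) u                   ≡⟨ padTo-padded u _ (m≤m⊔n (length u) (length v)) ⟩
  map just u ++ replicate _ nothing               ∎
  where open ≡-Reasoning

conv₂-proj₂ : (u : List A) (v : List B) →
  map proj₂ (conv₂ u v) ≡ map just v ++ replicate (length u ⊔ length v ∸ length v) nothing
conv₂-proj₂ u v = begin
  map proj₂ (conv₂ u v)                          ≡⟨ cong (map proj₂) (map-upTo _ _) ⟩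
  map proj₂ (applyUpTo (λ j → pad u j , pad v j) _) ≡⟨ map-applyUpTo _ proj₂ _ ⟩
  padTo (length u ⊔ length v) v                   ≡⟨ padTo-padded v _ (m≤n⊔m (length u) (length v)) ⟩
  map just v ++ replicate _ nothing               ∎
  where open ≡-Reasoning

conv₂-nonBlank : (u : List A) (v : List B) → All NonBlank (conv₂ u v)
conv₂-nonBlank u v = subst (All NonBlank) (sym (map-upTo _ _)) (applyUpTo⁺₁ _ _ nonBlank-at)
  where
  nonBlank-at : ∀ {j} → j < length u ⊔ length v → NonBlank (pad u j , pad v j)
  nonBlank-at {j} j<n with j <? length u | j <? length v
  ... | yes j<u | _ rewrite proj₂ (pad-just u j j<u) = left
  ... | no _ | yes j<v rewrite proj₂ (pad-just v j j<v) = right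
  ... | no j≮u | no j≮v = ⊥-elim (<⇒≱ j<n (⊔-lub (≮⇒≥ j≮u) (≮⇒≥ j≮v)))

conv₂-unique : {u : List A} {v : List B} {r r′ : ℕ} (x : List (Maybe A × Maybe B)) →
  map proj₁ x ≡ map just u ++ replicate r nothing → map proj₂ x ≡ map just v ++ replicate r′ nothing →
  All NonBlank x → conv₂ u v ≡ x
conv₂-unique {u = u} {v} x x₁≡ x₂≡ nonBlank = begin
  conv₂ u v                                      ≡⟨ map-upTo _ m ⟩
  applyUpTo (λ j → pad u j , pad v j) m          ≡⟨ cong (applyUpTo _) (≤-antisym (⊔-lub u≤n v≤n) n≤m) ⟩
  applyUpTo (λ j → pad u j , pad v j) (length x) ≡⟨ sym x≡applyUpTo ⟩
  x                                              ∎
  where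
  open ≡-Reasoning
  m = length u ⊔ length v
  padded-component : ∀ {C} {r} (f : _ → Maybe C) (w : List C) → map f x ≡ map just w ++ replicate r nothing →
    length w ≤ length x × map f x ≡ padTo (length x) w
  padded-component f w eq rewrite sym (length-map f x) = padded-padTo {u = w} (map f x) eq
  u≤n = proj₁ (padded-component proj₁ u x₁≡)
  v≤n = proj₁ (padded-component proj₂ v x₂≡)
  x≡applyUpTo : x ≡ applyUpTo (λ j → pad u j , pad v j) (length x)
  x≡applyUpTo = begin
    x                                           ≡⟨ sym (zip-map-proj x) ⟩
    zip (map proj₁ x) (map proj₂ x)             ≡⟨ cong₂ zip (proj₂ (padded-component proj₁ u x₁≡))
                                                             (proj₂ (padded-component proj₂ v x₂≡)) ⟩
    zip (padTo (length x) u) (padTo (length x) v) ≡⟨ zip-applyUpTo (pad u) (pad v) (length x) ⟩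
    applyUpTo (λ j → pad u j , pad v j) (length x) ∎
  n≤m : length x ≤ m
  n≤m = ≮⇒≥ λ m<n → blank (applyUpTo⁻ _ (length x) (subst (All NonBlank) x≡applyUpTo nonBlank) m<n)
    where
    blank : ¬ NonBlank (pad u m , pad v m)
    blank nb rewrite pad-nothing u m (m≤m⊔n (length u) (length v)) | pad-nothing v m (m≤n⊔m (length u) (length v))
      with nb
    ... | ()

-- Recognising ODDs

module _ {Γ : Set} {w : ℕ} where

  Continues : Subset w → Bool → List (Layer Γ w) → Set
  Continues r′ p []      = p ≡ true
  Continues r′ p (C ∷ E) = p ≡ false × ι C ≡ false × ℓ C ≡ r′ × Continues (r C) (φ C) E

  -- the part of IsODD (B ∷ E) not concerning ι B
  IsODDTail : Layer Γ w → List (Layer Γ w) → Set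
  IsODDTail B E =
    ((i j : Fin (suc (length E))) → suc (toℕ i) ≡ toℕ j → ℓ (lookup (B ∷ E) j) ≡ r (lookup (B ∷ E) i)) ×
    ((i : Fin (length E)) → ι (lookup E i) ≡ false) ×
    ((i : Fin (suc (length E))) → (φ (lookup (B ∷ E) i) ≡ true) ⇔ (suc (toℕ i) ≡ suc (length E)))

  IsODDTail⇔Continues : (B : Layer Γ w) (E : List (Layer Γ w)) → IsODDTail B E ⇔ Continues (r B) (φ B) E
  IsODDTail⇔Continues B [] = mk⇔
    (λ (_ , _ , final) → final fzero .from refl)
    (λ φB → (λ { fzero fzero () }) , (λ ()) , λ { fzero → mk⇔ (λ _ → refl) (λ _ → φB) })
  IsODDTail⇔Continues B (C ∷ E) = mk⇔
    (λ (linked , ¬initial , final) →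
       ¬-not (λ φB → 0≢1+n (suc-injective (final fzero .to φB))) , ¬initial fzero , linked fzero (fsuc fzero) refl ,
       IsODDTail⇔Continues C E .to
         ( (λ i j i+1≡j → linked (fsuc i) (fsuc j) (cong suc i+1≡j))
         , ¬initial ∘ fsuc
         , λ i → mk⇔ (suc-injective ∘ final (fsuc i) .to) (final (fsuc i) .from ∘ cong suc)))
    (λ (φB , ιC , ℓC , cont) →
       let (linked , ¬initial , final) = IsODDTail⇔Continues C E .from cont in
       (λ { fzero fzero () ; fzero (fsuc fzero) _ → ℓC ; fzero (fsuc (fsuc j)) ()
          ; (fsuc i) fzero () ; (fsuc i) (fsuc j) i+1≡j → linked i j (suc-injective i+1≡j) })
       , (λ { fzero → ιC ; (fsuc i) → ¬initial i })
       , λ { fzero → mk⇔ (λ φB′ → ⊥-elim (not-¬ refl (trans (sym φB′) φB))) (λ ())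
           ; (fsuc i) → mk⇔ (cong suc ∘ final i .to) (final i .from ∘ suc-injective) })

  IsODD-∷ : (B : Layer Γ w) (E : List (Layer Γ w)) → IsODD (B ∷ E) ⇔ (ι B ≡ true × Continues (r B) (φ B) E)
  IsODD-∷ B E = mk⇔
    (λ (_ , linked , initial , final) →
       initial fzero .from refl ,
       IsODDTail⇔Continues B E .to (linked , (λ i → ¬-not λ ιEi → 0≢1+n (sym (initial (fsuc i) .to ιEi))) , final))
    (λ (ιB , cont) →
       let (linked , ¬initial , final) = IsODDTail⇔Continues B E .from cont in
       s≤s z≤n , linked ,
       (λ { fzero    → mk⇔ (λ _ → refl) (λ _ → ιB)
          ; (fsuc i) → mk⇔ (λ ιEi → ⊥-elim (not-¬ refl (trans (sym ιEi) (¬initial i)))) (λ ()) }) ,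
       final)

  links? : (r′ : Subset w) (p : Bool) (C : Layer Γ w) → Dec (p ≡ false × ι C ≡ false × ℓ C ≡ r′)
  links? r′ p C = (p ≟ᵇ false) ×-dec (ι C ≟ᵇ false) ×-dec ≡-dec _≟ᵇ_ (ℓ C) r′

  -- state: whether all constraints so far hold, and (r, φ) of the last layer read
  oddᴬ : Automaton (Layer Γ w)
  oddᴬ = record
    { State  = Bool × Maybe (Subset w × Bool)
    ; finite = finite-× finite-Bool (finite-Maybe (finite-× (finite-Vec finite-Bool w) finite-Bool))
    ; start  = true , nothing
    ; step   = λ { (ok , nothing) B → ok ∧ ι B , just (r B , φ B)
                 ; (ok , just (r′ , p)) C → ok ∧ isYes (links? r′ p C) , just (r C , φ C) }
    ; accept = λ { (ok , nothing) → false ; (ok , just (_ , p)) → ok ∧ p }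
    }

  accepts-continues : ∀ ok r′ p E → (accept oddᴬ (run oddᴬ (ok , just (r′ , p)) E) ≡ true) ⇔ (ok ≡ true × Continues r′ p E)
  accepts-continues ok r′ p []      = ∧-true
  accepts-continues ok r′ p (C ∷ E) = mk⇔
    (λ acc → let (ok∧links , cont) = accepts-continues _ (r C) (φ C) E .to acc
                 (ok-true , links) = ∧-true .to ok∧links
                 (p-false , ιC , ℓC) = isYes-true (links? r′ p C) .to links
             in ok-true , p-false , ιC , ℓC , cont)
    (λ (ok-true , p-false , ιC , ℓC , cont) →
       accepts-continues _ (r C) (φ C) E .from
         (∧-true .from (ok-true , isYes-true (links? r′ p C) .from (p-false , ιC , ℓC)) , cont))

  accepts-odd : (D : List (Layer Γ w)) → Accepts oddᴬ D ⇔ IsODD D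
  accepts-odd []      = mk⇔ (λ ()) λ { (() , _) }
  accepts-odd (B ∷ E) = ⇔-trans (accepts-continues (ι B) (r B) (φ B) E) (⇔-sym (IsODD-∷ B E))

  paddedODDᴬ : Automaton (Maybe (Layer Γ w))
  paddedODDᴬ = paddedᴬ ∩ᴬ skipᴬ oddᴬ

  accepts-paddedODD : (zs : List (Maybe (Layer Γ w))) →
    Accepts paddedODDᴬ zs ⇔ (∃[ D ] ∃[ r ] IsODD D × zs ≡ map just D ++ replicate r nothing)
  accepts-paddedODD zs = mk⇔
    (λ acc → let (acc-padded , acc-odd) = accepts-∩ paddedᴬ (skipᴬ oddᴬ) zs .to acc
                 (D , r , _ , zs≡) = accepts-padded zs .to acc-padded
             in D , r , accepts-odd D .to (accepts-skip oddᴬ D r .to (subst (Accepts (skipᴬ oddᴬ)) zs≡ acc-odd)) , zs≡)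
    (λ { (D , r , odd , refl) → accepts-∩ paddedᴬ (skipᴬ oddᴬ) zs .from
           (accepts-padded zs .from (D , r , proj₁ odd , refl) , accepts-skip oddᴬ D r .from (accepts-odd D .from odd)) })

-- Runs of an ODD indexed by ℕ

clamp : (k : ℕ) → ℕ → Fin (suc k)
clamp k j with j ≤? k
... | yes j≤k = fromℕ< (s≤s j≤k)
... | no  _   = fzero

clamp-toℕ : (k : ℕ) (i : Fin (suc k)) → clamp k (toℕ i) ≡ i
clamp-toℕ k i with toℕ i ≤? k
... | yes i≤k = toℕ-injective (toℕ-fromℕ< (s≤s i≤k))
... | no  i≰k = ⊥-elim (i≰k (≤-pred (toℕ<n i)))

module _ {Γ : Set} {w : ℕ} where

  layerT : Maybe (Layer Γ w) → Fin w → Maybe Γ → Fin w → Bool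
  layerT nothing  _ _ _ = false
  layerT (just B)       = T B

  initials finals : Maybe (Layer Γ w) → Subset w
  initials = Maybe.maybe I (Vec.replicate w false)
  finals   = Maybe.maybe F (Vec.replicate w false)

  Run : List (Layer Γ w) → (ℕ → Maybe Γ) → (ℕ → Fin w) → Set
  Run D σ st =
    Vec.lookup (initials (pad D 0)) (st 0) ≡ true ×
    (∀ j → j < length D → layerT (pad D j) (st j) (σ j) (st (suc j)) ≡ true) ×
    (∀ j → suc j ≡ length D → Vec.lookup (finals (pad D j)) (st (suc j)) ≡ true)

  InLℕ : List (Layer Γ w) → List Γ → Set
  InLℕ D t = NonEmpty t × length t ≤ length D × ∃ (Run D (pad t))

  InL⇔InLℕ : (D : List (Layer Γ w)) (t : List Γ) → InL D t ⇔ InLℕ D t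
  InL⇔InLℕ D t = mk⇔ to′ from′
    where
    k = length D

    first-layer : (i : Fin k) → toℕ i ≡ 0 → pad D 0 ≡ just (lookup D i)
    first-layer i i≡0 = trans (cong (pad D) (sym i≡0)) (pad-lookup D i)

    to′ : InL D t → InLℕ D t
    to′ (t≢[] , t≤D , st , trans-ok , init-ok , final-ok) = t≢[] , t≤D , stℕ , init-ok′ , trans-ok′ , final-ok′
      where
      stℕ : ℕ → Fin w
      stℕ = st ∘ clamp k
      stℕ-inject : (i : Fin k) → stℕ (toℕ i) ≡ st (inject₁ i)
      stℕ-inject i = cong st (trans (cong (clamp k) (sym (toℕ-inject₁ i))) (clamp-toℕ k (inject₁ i)))
      stℕ-suc : (i : Fin k) → stℕ (suc (toℕ i)) ≡ st (fsuc i)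
      stℕ-suc i = cong st (clamp-toℕ k (fsuc i))
      init-ok′ : Vec.lookup (initials (pad D 0)) (stℕ 0) ≡ true
      init-ok′ = subst₂ (λ B q → Vec.lookup (initials B) q ≡ true) (sym (first-layer i i≡0))
                        (trans (sym (stℕ-inject i)) (cong stℕ i≡0)) ([]=⇒lookup (init-ok i i≡0))
        where
        i = fromℕ< (≤-trans t≢[] t≤D)
        i≡0 = toℕ-fromℕ< (≤-trans t≢[] t≤D)
      trans-ok′ : ∀ j → j < k → layerT (pad D j) (stℕ j) (pad t j) (stℕ (suc j)) ≡ true
      trans-ok′ j j<k with fromℕ< j<k | toℕ-fromℕ< j<k
      ... | i | refl rewrite pad-lookup D i | stℕ-inject i | stℕ-suc i = trans-ok i
      final-ok′ : ∀ j → suc j ≡ k → Vec.lookup (finals (pad D j)) (stℕ (suc j)) ≡ true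
      final-ok′ j j+1≡k with fromℕ< (≤-reflexive j+1≡k) | toℕ-fromℕ< (≤-reflexive j+1≡k)
      ... | i | refl rewrite pad-lookup D i | stℕ-suc i = []=⇒lookup (final-ok i j+1≡k)

    from′ : InLℕ D t → InL D t
    from′ (t≢[] , t≤D , stℕ , init-ok , trans-ok , final-ok) = t≢[] , t≤D , stℕ ∘ toℕ , trans-ok′ , init-ok′ , final-ok′
      where
      trans-ok′ : (i : Fin k) → T (lookup D i) (stℕ (toℕ (inject₁ i))) (pad t (toℕ i)) (stℕ (suc (toℕ i))) ≡ true
      trans-ok′ i with trans-ok (toℕ i) (toℕ<n i)
      ... | ok rewrite pad-lookup D i | toℕ-inject₁ i = ok
      init-ok′ : (i : Fin k) → toℕ i ≡ 0 → stℕ (toℕ (inject₁ i)) ∈ I (lookup D i)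
      init-ok′ i i≡0 = lookup⇒[]= _ _ (subst₂ (λ B q → Vec.lookup (initials B) q ≡ true) (first-layer i i≡0)
                                               (cong stℕ (sym (trans (toℕ-inject₁ i) i≡0))) init-ok)
      final-ok′ : (i : Fin k) → suc (toℕ i) ≡ k → stℕ (suc (toℕ i)) ∈ F (lookup D i)
      final-ok′ i i+1≡k = lookup⇒[]= _ _ (subst (λ B → Vec.lookup (finals B) (stℕ (suc (toℕ i))) ≡ true)
                                               (pad-lookup D i) (final-ok (toℕ i) i+1≡k))

-- Evaluating an ODD

update : {S : Set} → (ℕ → S) → ℕ → S → ℕ → S
update st j q t with t ≟ℕ j
... | yes _ = q
... | no  _ = st t

update-≡ : {S : Set} (st : ℕ → S) (j : ℕ) (q : S) → update st j q j ≡ q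
update-≡ st j q with j ≟ℕ j
... | yes _   = refl
... | no  j≢j = ⊥-elim (j≢j refl)

update-≢ : {S : Set} (st : ℕ → S) (j : ℕ) (q : S) (t : ℕ) → t ≢ j → update st j q t ≡ st t
update-≢ st j q t t≢j with t ≟ℕ j
... | yes t≡j = ⊥-elim (t≢j t≡j)
... | no  _   = refl

module _ {Γ : Set} {w : ℕ} where

  post? : (B : Layer Γ w) (P : Subset w) (σ : Maybe Γ) (q : Fin w) →
    Dec (∃[ p ] Vec.lookup P p ≡ true × T B p σ q ≡ true)
  post? B P σ q = any? λ p → (Vec.lookup P p ≟ᵇ true) ×-dec (T B p σ q ≟ᵇ true)

  post : Layer Γ w → Subset w → Maybe Γ → Subset w
  post B P σ = Vec.tabulate (isYes ∘ post? B P σ)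

  ∈-post : ∀ B P σ q → (Vec.lookup (post B P σ) q ≡ true) ⇔ (∃[ p ] Vec.lookup P p ≡ true × T B p σ q ≡ true)
  ∈-post B P σ q = ⇔-trans (mk⇔ (trans (sym lookup≡)) (trans lookup≡)) (isYes-true (post? B P σ q))
    where lookup≡ = lookup∘tabulate (isYes ∘ post? B P σ) q

  meets? : (P Q : Subset w) → Dec (∃[ q ] Vec.lookup P q ≡ true × Vec.lookup Q q ≡ true)
  meets? P Q = any? λ q → (Vec.lookup P q ≟ᵇ true) ×-dec (Vec.lookup Q q ≟ᵇ true)

  -- state: (states reachable so far, accepted so far); past the last layer only # may follow
  evalStep : Subset w × Bool → Maybe (Layer Γ w) × Maybe Γ → Subset w × Bool
  evalStep (P , _) (just B  , σ)       = post B P σ , isYes (meets? (post B P σ) (F B))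
  evalStep (P , a) (nothing , nothing) = P , a
  evalStep (P , _) (nothing , just _)  = P , false

  -- the initial states are only known once the first layer has been read
  evalᴬ : Automaton (Maybe (Layer Γ w) × Maybe Γ)
  evalᴬ = record
    { State  = Maybe (Subset w × Bool)
    ; finite = finite-Maybe (finite-× (finite-Vec finite-Bool w) finite-Bool)
    ; start  = nothing
    ; step   = λ { nothing (mB , σ) → just (evalStep (initials mB , false) (mB , σ)) ; (just c) z → just (evalStep c z) }
    ; accept = Maybe.maybe proj₂ false
    }

  module _ (D : List (Layer Γ w)) (σ : ℕ → Maybe Γ) where

    simulate : ℕ → Subset w × Bool
    simulate zero    = initials (pad D 0) , false
    simulate (suc j) = evalStep (simulate j) (pad D j , σ j)

    run-eval : ∀ n → run evalᴬ nothing (applyUpTo (λ j → pad D j , σ j) (suc n)) ≡ just (simulate (suc n))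
    run-eval zero    = refl
    run-eval (suc n) = begin
      run evalᴬ nothing (applyUpTo g (suc (suc n)))         ≡⟨ cong (run evalᴬ nothing) (sym (applyUpTo-∷ʳ g (suc n))) ⟩
      run evalᴬ nothing (applyUpTo g (suc n) ∷ʳ g (suc n))  ≡⟨ foldl-∷ʳ (step evalᴬ) nothing (g (suc n)) (applyUpTo g (suc n)) ⟩
      step evalᴬ (run evalᴬ nothing (applyUpTo g (suc n))) (g (suc n)) ≡⟨ cong (λ c → step evalᴬ c (g (suc n))) (run-eval n) ⟩
      just (simulate (suc (suc n)))                          ∎
      where
      open ≡-Reasoning
      g = λ j → pad D j , σ j

    PartialRun : ℕ → (ℕ → Fin w) → Set
    PartialRun j st = Vec.lookup (initials (pad D 0)) (st 0) ≡ true ×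
                      (∀ t → t < j → layerT (pad D t) (st t) (σ t) (st (suc t)) ≡ true)

    reachable : ∀ j → j ≤ length D → ∀ q → (Vec.lookup (proj₁ (simulate j)) q ≡ true) ⇔ (∃[ st ] PartialRun j st × st j ≡ q)
    reachable zero    _   q = mk⇔ (λ q∈I → (λ _ → q) , (q∈I , λ _ ()) , refl) λ { (st , (st0∈I , _) , refl) → st0∈I }
    reachable (suc j) j<D q with pad-just D j j<D
    ... | B , padDj≡B rewrite padDj≡B = mk⇔ to′ from′
      where
      IH : ∀ q → (Vec.lookup (proj₁ (simulate j)) q ≡ true) ⇔ (∃[ st ] PartialRun j st × st j ≡ q)
      IH = reachable j (≤-trans (n≤1+n j) j<D)
      to′ : Vec.lookup (post B (proj₁ (simulate j)) (σ j)) q ≡ true → ∃[ st ] PartialRun (suc j) st × st (suc j) ≡ q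
      to′ q∈ with ∈-post B (proj₁ (simulate j)) (σ j) q .to q∈
      ... | p , p∈ , p→q with IH p .to p∈
      ... | st , (st0∈I , steps) , refl = st′ , (init′ , steps′) , update-≡ st (suc j) q
        where
        st′ = update st (suc j) q
        init′ : Vec.lookup (initials (pad D 0)) (st′ 0) ≡ true
        init′ = subst (λ s → Vec.lookup (initials (pad D 0)) s ≡ true) (sym (update-≢ st (suc j) q 0 (λ ()))) st0∈I
        steps′ : ∀ t → t < suc j → layerT (pad D t) (st′ t) (σ t) (st′ (suc t)) ≡ true
        steps′ t t<j+1 with m≤n⇒m<n∨m≡n (≤-pred t<j+1)
        ... | inj₁ t<j rewrite update-≢ st (suc j) q t (<⇒≢ (m<n⇒m<1+n t<j))
                             | update-≢ st (suc j) q (suc t) (<⇒≢ (s≤s t<j)) = steps t t<j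
        ... | inj₂ refl rewrite update-≢ st (suc t) q t (<⇒≢ (n<1+n t)) | update-≡ st (suc t) q | padDj≡B = p→q
      from′ : (∃[ st ] PartialRun (suc j) st × st (suc j) ≡ q) → Vec.lookup (post B (proj₁ (simulate j)) (σ j)) q ≡ true
      from′ (st , (st0∈I , steps) , refl) = ∈-post B (proj₁ (simulate j)) (σ j) (st (suc j)) .from
        (st j , IH (st j) .from (st , (st0∈I , λ t t<j → steps t (m<n⇒m<1+n t<j)) , refl) ,
         subst (λ mB → layerT mB (st j) (σ j) (st (suc j)) ≡ true) padDj≡B (steps j (n<1+n j)))

    accepted-at-end : ∀ k₀ → suc k₀ ≡ length D → (proj₂ (simulate (suc k₀)) ≡ true) ⇔
      (∃[ st ] PartialRun (suc k₀) st × Vec.lookup (finals (pad D k₀)) (st (suc k₀)) ≡ true)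
    accepted-at-end k₀ k₀+1≡D with pad-just D k₀ (≤-reflexive k₀+1≡D)
    ... | B , padDk₀≡B = mk⇔ to′ from′
      where
      P′ : Subset w
      P′ = post B (proj₁ (simulate k₀)) (σ k₀)
      simulate≡ : simulate (suc k₀) ≡ (P′ , isYes (meets? P′ (F B)))
      simulate≡ rewrite padDk₀≡B = refl
      reachable′ : ∀ q → (Vec.lookup P′ q ≡ true) ⇔ (∃[ st ] PartialRun (suc k₀) st × st (suc k₀) ≡ q)
      reachable′ q = subst (λ P → (Vec.lookup P q ≡ true) ⇔ _) (cong proj₁ simulate≡)
                           (reachable (suc k₀) (≤-reflexive k₀+1≡D) q)
      finals≡ : ∀ q → Vec.lookup (finals (pad D k₀)) q ≡ Vec.lookup (F B) q
      finals≡ q = cong (λ mB → Vec.lookup (finals mB) q) padDk₀≡B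
      AcceptingRun : Set
      AcceptingRun = ∃[ st ] PartialRun (suc k₀) st × Vec.lookup (finals (pad D k₀)) (st (suc k₀)) ≡ true
      to′ : proj₂ (simulate (suc k₀)) ≡ true → AcceptingRun
      to′ acc with isYes-true (meets? P′ (F B)) .to (subst (λ c → proj₂ c ≡ true) simulate≡ acc)
      ... | q , q∈P′ , q∈F with reachable′ q .to q∈P′
      ... | st , partial , refl = st , partial , trans (finals≡ (st (suc k₀))) q∈F
      from′ : AcceptingRun → proj₂ (simulate (suc k₀)) ≡ true
      from′ (st , partial , final) = subst (λ c → proj₂ c ≡ true) (sym simulate≡) (isYes-true (meets? P′ (F B)) .from
        (st (suc k₀) , reachable′ (st (suc k₀)) .from (st , partial , refl) , trans (sym (finals≡ (st (suc k₀)))) final))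

    accepted-after : ∀ m → (proj₂ (simulate (m + length D)) ≡ true) ⇔
      (proj₂ (simulate (length D)) ≡ true × (∀ t → length D ≤ t → t < m + length D → σ t ≡ nothing))
    accepted-after zero = mk⇔ (_, λ t D≤t t<D → ⊥-elim (<⇒≱ t<D D≤t)) proj₁
    accepted-after (suc m) rewrite pad-nothing D (m + length D) (m≤n+m (length D) m) with σ (m + length D) in σ≡
    ... | just _  = mk⇔ (λ ())
      λ { (_ , only#) → ⊥-elim (just≢nothing (trans (sym σ≡) (only# _ (m≤n+m (length D) m) (n<1+n _)))) }
    ... | nothing = mk⇔
      (λ acc → let (acc-D , only#) = accepted-after m .to acc in acc-D , only#′ only#)
      (λ (acc-D , only#) → accepted-after m .from (acc-D , λ t D≤t t<n → only# t D≤t (m<n⇒m<1+n t<n)))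
      where
      only#′ : (∀ t → length D ≤ t → t < m + length D → σ t ≡ nothing) →
                 (∀ t → length D ≤ t → t < suc m + length D → σ t ≡ nothing)
      only#′ only# t D≤t t<n with m≤n⇒m<n∨m≡n (≤-pred t<n)
      ... | inj₁ t<n′ = only# t D≤t t<n′
      ... | inj₂ refl = σ≡

  accepts-eval : (D : List (Layer Γ w)) (t : List Γ) (n : ℕ) → NonEmpty D → length D ≤ n → NonEmpty t → length t ≤ n →
    Accepts evalᴬ (applyUpTo (λ j → pad D j , pad t j) n) ⇔ InL D t
  accepts-eval (B ∷ E) t zero    _ () _ _
  accepts-eval D@(B ∷ E) t (suc n) _ D≤n t≢[] t≤n =
    ⇔-trans accepts≡simulated (⇔-trans simulated⇔InLℕ (⇔-sym (InL⇔InLℕ D t)))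
    where
    k = length D
    m = suc n ∸ k
    simulated : Set
    simulated = proj₂ (simulate D (pad t) (suc n)) ≡ true
    accepts≡simulated : Accepts evalᴬ (applyUpTo (λ j → pad D j , pad t j) (suc n)) ⇔ simulated
    accepts≡simulated rewrite run-eval D (pad t) n = mk⇔ id id
    simulated⇔InLℕ : simulated ⇔ InLℕ D t
    simulated⇔InLℕ = mk⇔ to′ from′
      where
      m+k≡n = m∸n+n≡m D≤n
      to′ : simulated → InLℕ D t
      to′ acc with accepted-after D (pad t) m .to (subst (λ j → proj₂ (simulate D (pad t) j) ≡ true) (sym m+k≡n) acc)
      ... | acc-D , only# with accepted-at-end D (pad t) (length E) refl .to acc-D
      ... | st , (init , steps) , final =
        t≢[] ,
        length≤⇔padding t k (suc n) t≤n .from (λ j k≤j j<n → only# j k≤j (subst (j <_) (sym m+k≡n) j<n)) ,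
        st , init , steps , λ { j refl → final }
      from′ : InLℕ D t → simulated
      from′ (_ , t≤k , st , init , steps , final) = subst (λ j → proj₂ (simulate D (pad t) j) ≡ true) m+k≡n
        (accepted-after D (pad t) m .from
          ( accepted-at-end D (pad t) (length E) refl .from (st , (init , steps) , final (length E) refl)
          , λ j k≤j j<n → length≤⇔padding t k (suc n) t≤n .to t≤k j k≤j (subst (j <_) m+k≡n j<n)))

  InL? : (D : List (Layer Γ w)) (t : List Γ) → Dec (InL D t)
  InL? []        t     = no λ (t≢[] , t≤[] , _) → <⇒≱ t≢[] t≤[]
  InL? (B ∷ E)   []    = no λ ()
  InL? D@(B ∷ E) (a ∷ t) with length (a ∷ t) ≤? length D
  ... | no  t≰D = no λ (_ , t≤D , _) → t≰D t≤D
  ... | yes t≤D = map′ (accepts-eval D (a ∷ t) (length D) (s≤s z≤n) ≤-refl (s≤s z≤n) t≤D .to)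
                       (accepts-eval D (a ∷ t) (length D) (s≤s z≤n) ≤-refl (s≤s z≤n) t≤D .from)
                       (accepts? evalᴬ (applyUpTo (λ j → pad D j , pad (a ∷ t) j) (length D)))

-- Convolutions of several strings

column : {S : Set} {a : ℕ} → Fin a → List (Vec S a) → List S
column i = map (λ v → Vec.lookup v i)

module _ {S : Set} where

  length≤maxLen : {a : ℕ} (us : Vec (List S) a) (i : Fin a) → length (Vec.lookup us i) ≤ maxLen us
  length≤maxLen (u Vec.∷ us) fzero    = m≤m⊔n (length u) (maxLen us)
  length≤maxLen (u Vec.∷ us) (fsuc i) = ≤-trans (length≤maxLen us i) (m≤n⊔m (length u) (maxLen us))

  maxLen-const : {a : ℕ} (us : Vec (List S) (suc a)) (m : ℕ) → (∀ i → length (Vec.lookup us i) ≡ m) → maxLen us ≡ m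
  maxLen-const {zero}  (u Vec.∷ Vec.[]) m |u|≡m = trans (⊔-identityʳ (length u)) (|u|≡m fzero)
  maxLen-const {suc a} (u Vec.∷ us)     m |u|≡m =
    trans (cong₂ _⊔_ (|u|≡m fzero) (maxLen-const us m (|u|≡m ∘ fsuc))) (⊔-idem m)

  length-conv : {a : ℕ} (us : Vec (List S) a) → length (conv us) ≡ maxLen us
  length-conv us = trans (length-map _ (upTo (maxLen us))) (length-upTo (maxLen us))

  pad-conv : {a : ℕ} (us : Vec (List S) a) {j : ℕ} → j < maxLen us → pad (conv us) j ≡ just (Vec.map (λ u → pad u j) us)
  pad-conv us j<max rewrite map-upTo (λ j → Vec.map (λ u → pad u j) us) (maxLen us) = pad-applyUpTo _ j<max

  conv-injective : {a : ℕ} {us vs : Vec (List S) a} → conv us ≡ conv vs → us ≡ vs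
  conv-injective {us = us} {vs} conv≡ =
    trans (sym (tabulate∘lookup us)) (trans (tabulate-cong λ i → pad-injective (pad≗ i)) (tabulate∘lookup vs))
    where
    max≡ : maxLen us ≡ maxLen vs
    max≡ = trans (sym (length-conv us)) (trans (cong length conv≡) (length-conv vs))
    pad≗ : ∀ i j → pad (Vec.lookup us i) j ≡ pad (Vec.lookup vs i) j
    pad≗ i j with j <? maxLen us
    ... | yes j<max = begin
      pad (Vec.lookup us i) j                    ≡⟨ sym (lookup-map i (λ u → pad u j) us) ⟩
      Vec.lookup (Vec.map (λ u → pad u j) us) i ≡⟨ cong (λ v → Vec.lookup v i) columns≡ ⟩
      Vec.lookup (Vec.map (λ u → pad u j) vs) i ≡⟨ lookup-map i (λ u → pad u j) vs ⟩
      pad (Vec.lookup vs i) j                    ∎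
      where
      open ≡-Reasoning
      columns≡ = just-injective (trans (sym (pad-conv us j<max))
                                       (trans (cong (λ z → pad z j) conv≡) (pad-conv vs (subst (j <_) max≡ j<max))))
    ... | no j≮max = trans (pad-nothing (Vec.lookup us i) j (≤-trans (length≤maxLen us i) (≮⇒≥ j≮max)))
                           (sym (pad-nothing (Vec.lookup vs i) j (≤-trans (length≤maxLen vs i) (subst (_≤ j) max≡ (≮⇒≥ j≮max)))))

  conv-columns : {a : ℕ} (x : List (Vec S (suc a))) → conv (Vec.tabulate λ i → column i x) ≡ map (Vec.map just) x
  conv-columns x = begin
    conv us                                                  ≡⟨ map-upTo _ (maxLen us) ⟩
    applyUpTo (λ j → Vec.map (λ u → pad u j) us) (maxLen us)  ≡⟨ cong (applyUpTo _) max≡ ⟩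
    applyUpTo (λ j → Vec.map (λ u → pad u j) us) (length x)   ≡⟨ applyUpTo-cong entry≡ (length x) ⟩
    applyUpTo (spread ∘ pad x) (length x)                     ≡⟨ applyUpTo-pad spread x ⟩
    map (spread ∘ just) x                                     ≡⟨ map-cong spread-just x ⟩
    map (Vec.map just) x                                      ∎
    where
    open ≡-Reasoning
    us = Vec.tabulate λ i → column i x
    spread : Maybe (Vec S _) → Vec (Maybe S) _
    spread c = Vec.tabulate λ i → Maybe.map (λ v → Vec.lookup v i) c
    max≡ : maxLen us ≡ length x
    max≡ = maxLen-const us (length x) λ i → trans (cong length (lookup∘tabulate (λ i → column i x) i)) (length-map _ x)
    entry≡ : ∀ j → Vec.map (λ u → pad u j) us ≡ spread (pad x j)
    entry≡ j = trans (sym (tabulate-∘ (λ u → pad u j) (λ i → column i x))) (tabulate-cong λ i → pad-map (λ v → Vec.lookup v i) x j)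
    spread-just : ∀ v → spread (just v) ≡ Vec.map just v
    spread-just v = trans (tabulate-∘ just (Vec.lookup v)) (cong (Vec.map just) (tabulate∘lookup v))

  Pow⇔columns : {a : ℕ} → 0 < a → (L : List S → Set) (x : List (Vec S a)) →
    Pow a L (map (Vec.map just) x) ⇔ (∀ i → L (column i x))
  Pow⇔columns {suc a} _ L x = mk⇔
    (λ (us , L-us , conv≡) i →
       subst L (trans (cong (λ vs → Vec.lookup vs i) (conv-injective (trans conv≡ (sym (conv-columns x)))))
                      (lookup∘tabulate (λ i → column i x) i)) (L-us i))
    (λ L-columns → Vec.tabulate (λ i → column i x) ,
                   (λ i → subst L (sym (lookup∘tabulate (λ i → column i x) i)) (L-columns i)) ,
                   conv-columns x)

-- The automaton for R_⊆

module _ {S : Set} (FS : Finite S) (w a : ℕ) where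

  Letter : Set
  Letter = Maybe (Layer S w) × Maybe (Layer (Vec S a) w)

  Counterexample : Fin a → List (Layer S w) → List (Layer (Vec S a) w) → Set
  Counterexample i D D′ = ∃[ y ] InL D′ y × ¬ InL D (column i y)

  -- the automata below read (D ⊗ D′) together with a guessed #-padding of y
  paddedGuessᴬ : Automaton (Letter × Maybe (Vec S a))
  paddedGuessᴬ = comapᴬ proj₂ paddedᴬ

  guessInD′ᴬ : Automaton (Letter × Maybe (Vec S a))
  guessInD′ᴬ = comapᴬ (λ ((_ , mB′) , c) → mB′ , c) evalᴬ

  columnInDᴬ : Fin a → Automaton (Letter × Maybe (Vec S a))
  columnInDᴬ i = comapᴬ (λ ((mB , _) , c) → mB , Maybe.map (λ v → Vec.lookup v i) c) evalᴬ

  counterexampleᴬ : Fin a → Automaton (Letter × Maybe (Vec S a))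
  counterexampleᴬ i = paddedGuessᴬ ∩ᴬ (guessInD′ᴬ ∩ᴬ ∁ᴬ (columnInDᴬ i))

  ∃counterexampleᴬ : Fin a → Automaton Letter
  ∃counterexampleᴬ i = ∃ᴬ (finite-Maybe (finite-Vec FS a)) (counterexampleᴬ i)

  module _ (i : Fin a) (u : List (Layer S w)) (v : List (Layer (Vec S a) w)) (u≢[] : NonEmpty u) (v≢[] : NonEmpty v) where

    private
      n = length u ⊔ length v

    accepts-counterexample-padTo : (y : List (Vec S a)) → NonEmpty y → length y ≤ n →
      Accepts (counterexampleᴬ i) (applyUpTo (λ j → (pad u j , pad v j) , pad y j) n) ⇔ (InL v y × ¬ InL u (column i y))
    accepts-counterexample-padTo y y≢[] y≤n = mk⇔
      (λ acc → let (_ , acc-D′∩∁D) = accepts-∩ paddedGuessᴬ (guessInD′ᴬ ∩ᴬ ∁ᴬ (columnInDᴬ i)) zs .to acc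
                   (acc-D′ , acc-∁D) = accepts-∩ guessInD′ᴬ (∁ᴬ (columnInDᴬ i)) zs .to acc-D′∩∁D
               in in-D′ .to acc-D′ , λ in-D → accepts-∁ (columnInDᴬ i) zs .to acc-∁D (in-D-col .from in-D))
      (λ (in-v , ∉u) → accepts-∩ paddedGuessᴬ (guessInD′ᴬ ∩ᴬ ∁ᴬ (columnInDᴬ i)) zs .from
         (padded-y , accepts-∩ guessInD′ᴬ (∁ᴬ (columnInDᴬ i)) zs .from
                       (in-D′ .from in-v , accepts-∁ (columnInDᴬ i) zs .from (∉u ∘ in-D-col .to))))
      where
      g = λ j → (pad u j , pad v j) , pad y j
      zs = applyUpTo g n
      col = λ (c : Vec S a) → Vec.lookup c i
      padded-y : Accepts paddedGuessᴬ zs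
      padded-y = accepts-comap proj₂ paddedᴬ zs .from (accepts-resp paddedᴬ (sym (map-applyUpTo g proj₂ n)) .to
        (accepts-padded _ .from (y , n ∸ length y , y≢[] , padTo-padded y n y≤n)))
      in-D′ : Accepts guessInD′ᴬ zs ⇔ InL v y
      in-D′ = ⇔-trans (accepts-comap _ evalᴬ zs) (⇔-trans (accepts-resp evalᴬ (map-applyUpTo g _ n))
                (accepts-eval v y n v≢[] (m≤n⊔m (length u) (length v)) y≢[] y≤n))
      column≢[] : NonEmpty (column i y)
      column≢[] = subst (0 <_) (sym (length-map col y)) y≢[]
      column≤n : length (column i y) ≤ n
      column≤n = subst (_≤ n) (sym (length-map col y)) y≤n
      in-D-col : Accepts (columnInDᴬ i) zs ⇔ InL u (column i y)
      in-D-col = ⇔-trans (accepts-comap _ evalᴬ zs)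
        (⇔-trans (accepts-resp evalᴬ (trans (map-applyUpTo g _ n) (applyUpTo-cong (λ j → cong (pad u j ,_) (sym (pad-map col y j))) n)))
                 (accepts-eval u (column i y) n u≢[] (m≤m⊔n (length u) (length v)) column≢[] column≤n))

    accepts-∃-counterexample : Accepts (∃counterexampleᴬ i) (conv₂ u v) ⇔ Counterexample i u v
    accepts-∃-counterexample =
      ⇔-trans (accepts-∃ (finite-Maybe (finite-Vec FS a)) (counterexampleᴬ i) (conv₂ u v)) (mk⇔ to′ from′)
      where
      Guessed : Set
      Guessed = ∃[ ys ] length ys ≡ length (conv₂ u v) × Accepts (counterexampleᴬ i) (zip (conv₂ u v) ys)
      h = λ j → pad u j , pad v j
      |conv₂| : length (conv₂ u v) ≡ n
      |conv₂| = trans (length-map _ (upTo n)) (length-upTo n)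
      zip-conv₂ : ∀ y → zip (conv₂ u v) (padTo n y) ≡ applyUpTo (λ j → h j , pad y j) n
      zip-conv₂ y = trans (cong (λ x → zip x (padTo n y)) (map-upTo h n)) (zip-applyUpTo h (pad y) n)
      to′ : Guessed → Counterexample i u v
      to′ (ys , |ys|≡ , acc) =
        let zs = zip (conv₂ u v) ys
            acc-padded = accepts-comap proj₂ paddedᴬ zs .to
                           (proj₁ (accepts-∩ paddedGuessᴬ (guessInD′ᴬ ∩ᴬ ∁ᴬ (columnInDᴬ i)) zs .to acc))
            (y , r , y≢[] , ys≡) = accepts-padded ys .to
                                     (subst (Accepts paddedᴬ) (map-proj₂-zip (conv₂ u v) ys |ys|≡) acc-padded)
            (y≤ys , ys≡padTo) = padded-padTo {u = y} ys ys≡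
            |ys|≡n = trans |ys|≡ |conv₂|
            ys≡padTo-n = trans ys≡padTo (cong (λ m → padTo m y) |ys|≡n)
            acc′ = accepts-resp (counterexampleᴬ i) (trans (cong (zip (conv₂ u v)) ys≡padTo-n) (zip-conv₂ y)) .to acc
        in y , accepts-counterexample-padTo y y≢[] (subst (length y ≤_) |ys|≡n y≤ys) .to acc′
      from′ : Counterexample i u v → Guessed
      from′ (y , y∈v , y∉u) =
        padTo n y , trans (length-applyUpTo (pad y) n) (sym |conv₂|) ,
        accepts-resp (counterexampleᴬ i) (zip-conv₂ y) .from
          (accepts-counterexample-padTo y (proj₁ y∈v) (≤-trans (proj₁ (proj₂ y∈v)) (m≤n⊔m (length u) (length v))) .from
            (y∈v , y∉u))

  Included : List (Layer S w) → List (Layer (Vec S a) w) → Set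
  Included D D′ = (x : List (Vec S a)) → InL D′ x → Pow a (InL D) (map (Vec.map just) x)

  -- the converse direction needs decidability of InL
  Included⇔noCounterexample : 0 < a → (D : List (Layer S w)) (D′ : List (Layer (Vec S a) w)) →
    Included D D′ ⇔ (∀ i → ¬ Counterexample i D D′)
  Included⇔noCounterexample 0<a D D′ = mk⇔
    (λ incl i (y , y∈D′ , column∉D) → column∉D (Pow⇔columns 0<a (InL D) y .to (incl y y∈D′) i))
    (λ none x x∈D′ → Pow⇔columns 0<a (InL D) x .from λ i →
       decidable-stable (InL? D (column i x)) λ column∉D → none i (x , x∈D′ , column∉D))

  inclusionᴬ : Automaton Letter
  inclusionᴬ = ⋂ᴬ λ i → ∁ᴬ (∃counterexampleᴬ i)

  accepts-inclusion : 0 < a → (u : List (Layer S w)) (v : List (Layer (Vec S a) w)) → NonEmpty u → NonEmpty v →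
    Accepts inclusionᴬ (conv₂ u v) ⇔ Included u v
  accepts-inclusion 0<a u v u≢[] v≢[] =
    ⇔-trans (accepts-⋂ (λ i → ∁ᴬ (∃counterexampleᴬ i)) x)
      (⇔-trans (mk⇔ (λ acc i → accepts-∁ (∃counterexampleᴬ i) x .to (acc i) ∘ counterexample⇔ i .from)
                    (λ none i → accepts-∁ (∃counterexampleᴬ i) x .from (none i ∘ counterexample⇔ i .to)))
               (⇔-sym (Included⇔noCounterexample 0<a u v)))
    where
    x = conv₂ u v
    counterexample⇔ : ∀ i → Accepts (∃counterexampleᴬ i) x ⇔ Counterexample i u v
    counterexample⇔ i = accepts-∃-counterexample i u v u≢[] v≢[]

  firstODDᴬ secondODDᴬ : Automaton Letter
  firstODDᴬ  = comapᴬ proj₁ paddedODDᴬ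
  secondODDᴬ = comapᴬ proj₂ paddedODDᴬ

  Rsubᴬ : Automaton Letter
  Rsubᴬ = firstODDᴬ ∩ᴬ (secondODDᴬ ∩ᴬ (allᴬ nonBlank? ∩ᴬ inclusionᴬ))

  RsubConditions : List Letter → Set
  RsubConditions x =
    Accepts paddedODDᴬ (map proj₁ x) × Accepts paddedODDᴬ (map proj₂ x) × All NonBlank x × Accepts inclusionᴬ x

  accepts-Rsubᴬ : ∀ x → Accepts Rsubᴬ x ⇔ RsubConditions x
  accepts-Rsubᴬ x =
    ⇔-trans (accepts-∩ firstODDᴬ (secondODDᴬ ∩ᴬ (allᴬ nonBlank? ∩ᴬ inclusionᴬ)) x) (accepts-comap proj₁ paddedODDᴬ x ×-⇔
    ⇔-trans (accepts-∩ secondODDᴬ (allᴬ nonBlank? ∩ᴬ inclusionᴬ) x) (accepts-comap proj₂ paddedODDᴬ x ×-⇔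
    ⇔-trans (accepts-∩ (allᴬ nonBlank?) inclusionᴬ x) (accepts-all nonBlank? x ×-⇔ ⇔-refl)))

  Rsub-witness : List Letter → Set
  Rsub-witness x = ∃[ u ] ∃[ v ] NonEmpty u × NonEmpty v × Rsub S w a u v × conv₂ u v ≡ x

  RsubConditions⇔witness : 0 < a → (x : List Letter) → RsubConditions x ⇔ Rsub-witness x
  RsubConditions⇔witness 0<a x = mk⇔ to′ from′
    where
    to′ : RsubConditions x → Rsub-witness x
    to′ (acc₁ , acc₂ , nonBlank , acc-incl) =
      u , v , proj₁ odd-u , proj₁ odd-v , (odd-u , odd-v , incl) , conv≡
      where
      first  = accepts-paddedODD (map proj₁ x) .to acc₁
      second = accepts-paddedODD (map proj₂ x) .to acc₂
      u = proj₁ first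
      v = proj₁ second
      odd-u : IsODD u
      odd-u = proj₁ (proj₂ (proj₂ first))
      odd-v : IsODD v
      odd-v = proj₁ (proj₂ (proj₂ second))
      conv≡ : conv₂ u v ≡ x
      conv≡ = conv₂-unique {u = u} {v} {proj₁ (proj₂ first)} {proj₁ (proj₂ second)} x
                (proj₂ (proj₂ (proj₂ first))) (proj₂ (proj₂ (proj₂ second))) nonBlank
      incl : Included u v
      incl = accepts-inclusion 0<a u v (proj₁ odd-u) (proj₁ odd-v) .to (subst (Accepts inclusionᴬ) (sym conv≡) acc-incl)
    from′ : Rsub-witness x → RsubConditions x
    from′ (u , v , u≢[] , v≢[] , (odd-u , odd-v , incl) , conv≡) = subst RsubConditions conv≡
      ( accepts-paddedODD (map proj₁ (conv₂ u v)) .from (u , _ , odd-u , conv₂-proj₁ u v)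
      , accepts-paddedODD (map proj₂ (conv₂ u v)) .from (v , _ , odd-v , conv₂-proj₂ u v)
      , conv₂-nonBlank u v
      , accepts-inclusion 0<a u v u≢[] v≢[] .from incl )

proposition7 : (s w a : ℕ) → 0 < w → 0 < a → Regular₂ (Rsub (Fin s) w a)
proposition7 s w a _ 0<a = toDFA (Rsubᴬ Fs w a) , λ x →
  ⇔-trans (accepts-toDFA (Rsubᴬ Fs w a) x) (⇔-trans (accepts-Rsubᴬ Fs w a x) (RsubConditions⇔witness Fs w a 0<a x))
  where
  Fs : Finite (Fin s)
  Fs = finite-Fin s
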